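{- Let $\Sigma$ be a set, $A\subseteq\wp(\Sigma)$ a disjunctive abstract domain, $S\subseteq\Sigma$, and $A'=\mathcal{D}(A\cup\{S\})$. Let $P=\mathrm{pr}(A)$ and $P'=P\curlywedge\{S,\Sigma\smallsetminus S\}$. Then $\mathrm{pr}(A')=P'$, and for all $B',C'\in P'$: (i) if $B'\cap S=\varnothing$ then $C'\unlhd_{A'}B'\iff C'\subseteq\mu_A(\mathrm{parent}(B'))$; (ii) if $B'\cap S\neq\varnothing$ then $C'\unlhd_{A'}B'\iff C'\subseteq\mu_A(\mathrm{parent}(B'))\cap S$.
   Context: An abstract domain is a set $A\subseteq\wp(\Sigma)$ closed under arbitrary intersections (so $\Sigma\in A$); it is disjunctive if also closed under arbitrary unions. For $X\subseteq\wp(\Sigma)$, $\mathcal{D}(X)$ is the least subset of $\wp(\Sigma)$ containing $X$ and closed under arbitrary intersections and arbitrary unions. $\mu_A(T)=\bigcap\{X\in A\mid T\subseteq X\}$. $\mathrm{pr}(A)$ is the partition of $\Sigma$ where $s,s'$ share a block iff $\mu_A(\{s\})=\mu_A(\{s'\})$. For $B_1,B_2\in\mathrm{pr}(A)$, $B_1\unlhd_A B_2$ iff $\mu_A(B_1)\subseteq\mu_A(B_2)$ (similarly for $A'$). $P\curlywedge\{S,\Sigma\smallsetminus S\}$ is the partition whose blocks are the nonempty sets among $B\cap S$ and $B\smallsetminus S$ for $B\in P$. For $B'\in P'$, $\mathrm{parent}(B')$ is the unique block of $P$ containing $B'$. -}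

module Defs where

open import Level using (0ℓ)
open import Data.Bool using (Bool; true)
open import Data.Product using (Σ-syntax; ∃; _×_)
open import Data.Sum using (_⊎_)
open import Relation.Binary.PropositionalEquality using (_≡_)
open import Relation.Unary
  using (Pred; _⊆_; _≐_; _∩_; _∖_; ｛_｝; Empty; Satisfiable)
open import Relation.Nullary using (¬_)
open import Function.Bundles using (_⇔_)

-- Classical representation of the powerset:
--   ℘(St)      = St → Bool        (a subset, by its characteristic function)
--   ℘(℘(St))   = Sub St → Bool    (a family of subsets, e.g. an abstract domain)
Sub : Set → Set
Sub St = St → Bool

Fam : Set → Set
Fam St = Sub St → Bool

module _ {St : Set} where

  ⟦_⟧ : Sub St → Pred St 0ℓ
  ⟦ X ⟧ s = X s ≡ true

  _∈F_ : Sub St → Fam St → Set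
  X ∈F 𝓕 = 𝓕 X ≡ true

  ⋂ : Fam St → Pred St 0ℓ
  ⋂ 𝓕 s = ∀ Y → Y ∈F 𝓕 → Y s ≡ true

  ⋃ : Fam St → Pred St 0ℓ
  ⋃ 𝓕 s = Σ[ Y ∈ Sub St ] (Y ∈F 𝓕 × Y s ≡ true)

  IntersectionClosed : Pred (Sub St) 0ℓ → Set
  IntersectionClosed A =
    ∀ (𝓕 : Fam St) → (∀ Y → Y ∈F 𝓕 → A Y) → ∀ X → ⟦ X ⟧ ≐ ⋂ 𝓕 → A X

  UnionClosed : Pred (Sub St) 0ℓ → Set
  UnionClosed A =
    ∀ (𝓕 : Fam St) → (∀ Y → Y ∈F 𝓕 → A Y) → ∀ X → ⟦ X ⟧ ≐ ⋃ 𝓕 → A X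

  -- abstract domain: closed under arbitrary intersections (hence St ∈ A)
  AbstractDomain : Fam St → Set
  AbstractDomain A = IntersectionClosed (_∈F A)

  Disjunctive : Fam St → Set
  Disjunctive A = AbstractDomain A × UnionClosed (_∈F A)

  IsDClosure : Pred (Sub St) 0ℓ → Fam St → Set
  IsDClosure G A' =
    (∀ X → G X → X ∈F A')
    × IntersectionClosed (_∈F A')
    × UnionClosed (_∈F A')
    × (∀ (𝒞 : Fam St) → (∀ X → G X → X ∈F 𝒞)
         → IntersectionClosed (_∈F 𝒞) → UnionClosed (_∈F 𝒞)
         → ∀ X → X ∈F A' → X ∈F 𝒞)

  _∪｛_｝ : Fam St → Sub St → Pred (Sub St) 0ℓ
  (A ∪｛ S ｝) X = X ∈F A ⊎ (⟦ X ⟧ ≐ ⟦ S ⟧)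

  μ : Fam St → Pred St 0ℓ → Pred St 0ℓ
  μ A T s = ∀ X → X ∈F A → T ⊆ ⟦ X ⟧ → X s ≡ true

  IsPrBlock : Fam St → Pred St 0ℓ → Set
  IsPrBlock A B = ∃ λ s → B ≐ (λ s' → μ A ｛ s' ｝ ≐ μ A ｛ s ｝)

  IsRefinedBlock : Fam St → Sub St → Pred St 0ℓ → Set₁
  IsRefinedBlock A S B' = ∃ λ B → IsPrBlock A B ×
    ((Satisfiable (B ∩ ⟦ S ⟧) × B' ≐ (B ∩ ⟦ S ⟧))
     ⊎ (Satisfiable (B ∖ ⟦ S ⟧) × B' ≐ (B ∖ ⟦ S ⟧)))

  IsParent : Fam St → Pred St 0ℓ → Pred St 0ℓ → Set
  IsParent A B' B = IsPrBlock A B × B' ⊆ B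

  _⊴[_]_ : Pred St 0ℓ → Fam St → Pred St 0ℓ → Set
  B₁ ⊴[ A ] B₂ = μ A B₁ ⊆ μ A B₂

{-# OPTIONS --safe #-}
-- Write s ⊑ x when x ∈ μ_A({s}) and (s ∈ S ⇒ x ∈ S).  Every member of A ∪ {S}
-- is ⊑-upward closed, and upward closure survives arbitrary intersections and
-- unions, so every member of A' is upward closed; as A ∪ {S} ⊆ A', this gives
-- μ_A'({s}) = {x | s ⊑ x}.  Hence s, s' share a block of pr(A') iff they share
-- a block of pr(A) and lie on the same side of S, and for any t ∈ B' we get
-- μ_A'(B') = μ_A(parent(B')) ∩ {x | t ∈ S ⇒ x ∈ S}.
module Submission where

open import Defs
open import Level using (0ℓ)
open import Data.Bool using (true)
open import Data.Bool.Properties using (_≟_; T-≡)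
open import Data.Empty using (⊥-elim)
open import Data.Product using (_×_; _,_; proj₁; proj₂; ∃; map; map₂)
open import Data.Sum using (inj₁; inj₂)
open import Axiom.ExcludedMiddle using (ExcludedMiddle)
open import Axiom.DoubleNegationElimination using (em⇒dne)
open import Function.Base using (_∘_)
open import Function.Bundles using (_⇔_; mk⇔; Equivalence)
import Function.Properties.Equivalence as ⇔
open import Relation.Binary.Core using (Rel)
open import Relation.Binary.PropositionalEquality using (_≡_; refl)
open import Relation.Nullary using (¬_; yes; no)
open import Relation.Nullary.Decidable using (isYes; toWitness; fromWitness)
open import Relation.Unary
  using (Pred; _⊆_; _≐_; _∩_; ∁; ｛_｝; Empty; Satisfiable)
open import Relation.Unary.Properties using (≐-refl; ≐-sym; ≐-trans)

module _ {St : Set} where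

  ∩-cong : {P P′ Q Q′ : Pred St 0ℓ} → P ≐ P′ → Q ≐ Q′ → (P ∩ Q) ≐ (P′ ∩ Q′)
  ∩-cong (P⊆P′ , P′⊆P) (Q⊆Q′ , Q′⊆Q) = map P⊆P′ Q⊆Q′ , map P′⊆P Q′⊆Q

  ⊆-respʳ-≐ : {C P Q : Pred St 0ℓ} → P ≐ Q → (C ⊆ P) ⇔ (C ⊆ Q)
  ⊆-respʳ-≐ (P⊆Q , Q⊆P) = mk⇔ (λ C⊆P {x} Cx → P⊆Q (C⊆P Cx)) (λ C⊆Q {x} Cx → Q⊆P (C⊆Q Cx))

module _ {St : Set} (F : Fam St) where

  Block : St → Pred St 0ℓ
  Block s s′ = μ F ｛ s′ ｝ ≐ μ F ｛ s ｝

  μ-extensive : {T : Pred St 0ℓ} → T ⊆ μ F T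
  μ-extensive Tx X _ T⊆X = T⊆X Tx

  μ-least : {T U : Pred St 0ℓ} → T ⊆ μ F U → μ F T ⊆ μ F U
  μ-least T⊆μU x∈μT X X∈F U⊆X = x∈μT X X∈F (λ Ty → T⊆μU Ty X X∈F U⊆X)

  ⊴⇔⊆μ : {C B : Pred St 0ℓ} → C ⊴[ F ] B ⇔ C ⊆ μ F B
  ⊴⇔⊆μ = mk⇔ (λ C⊴B {x} Cx → C⊴B (μ-extensive Cx)) μ-least

  μ-≐-singleton : {T : Pred St 0ℓ} {t : St} → T t → T ⊆ μ F ｛ t ｝ → μ F T ≐ μ F ｛ t ｝
  μ-≐-singleton Tt T⊆μt = μ-least T⊆μt , μ-least λ { refl → μ-extensive Tt }

  Block⇔ : {s y : St} → Block s y ⇔ (μ F ｛ s ｝ y × μ F ｛ y ｝ s)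
  Block⇔ = mk⇔ (λ (μy⊆μs , μs⊆μy) → μy⊆μs (μ-extensive refl) , μs⊆μy (μ-extensive refl))
               (λ (y∈μs , s∈μy) → μ-least (λ { refl → y∈μs }) , μ-least (λ { refl → s∈μy }))

  Block-⊆-μ : {s : St} → Block s ⊆ μ F ｛ s ｝
  Block-⊆-μ s~y = proj₁ (Equivalence.to Block⇔ s~y)

  IsPrBlock-rep : {B : Pred St 0ℓ} {t : St} → IsPrBlock F B → B t → B ≐ Block t
  IsPrBlock-rep (s , B≐Block-s) Bt = ≐-trans B≐Block-s (Block-s≐Block-t (proj₁ B≐Block-s Bt))
    where
    Block-s≐Block-t : ∀ {t} → Block s t → Block s ≐ Block t
    Block-s≐Block-t t∈Block-s = (λ e → ≐-trans e (≐-sym t∈Block-s)) , (λ e → ≐-trans e t∈Block-s)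

  μ-IsPrBlock : {B : Pred St 0ℓ} {t : St} → IsPrBlock F B → B t → μ F B ≐ μ F ｛ t ｝
  μ-IsPrBlock B-block Bt = μ-≐-singleton Bt (λ By → Block-⊆-μ (proj₁ (IsPrBlock-rep B-block Bt) By))

module _ {St : Set} where

  UpClosed : Rel St 0ℓ → Pred (Sub St) 0ℓ
  UpClosed _≤_ X = ∀ {s x} → s ≤ x → X s ≡ true → X x ≡ true

  UpClosed-∩closed : {_≤_ : Rel St 0ℓ} → IntersectionClosed (UpClosed _≤_)
  UpClosed-∩closed 𝓕 up X (X⊆⋂ , ⋂⊆X) s≤x Xs =
    ⋂⊆X (λ Y Y∈𝓕 → up Y Y∈𝓕 s≤x (X⊆⋂ Xs Y Y∈𝓕))

  UpClosed-∪closed : {_≤_ : Rel St 0ℓ} → UnionClosed (UpClosed _≤_)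
  UpClosed-∪closed 𝓕 up X (X⊆⋃ , ⋃⊆X) s≤x Xs =
    let (Y , Y∈𝓕 , Ys) = X⊆⋃ Xs in ⋃⊆X (Y , Y∈𝓕 , up Y Y∈𝓕 s≤x Ys)

  -- Excluded middle turns P into a Bool-valued family, so that the
  -- leastness clause of IsDClosure applies to it.
  IsDClosure-ind : ExcludedMiddle 0ℓ → {G : Pred (Sub St) 0ℓ} {A′ : Fam St} →
                   IsDClosure G A′ → (P : Pred (Sub St) 0ℓ) →
                   G ⊆ P → IntersectionClosed P → UnionClosed P → (_∈F A′) ⊆ P
  IsDClosure-ind em (_ , _ , _ , least) P G⊆P ∩P ∪P {X} X∈A′ =
    decode (least 𝒫 (λ Y GY → encode (G⊆P GY)) ∩𝒫 ∪𝒫 X X∈A′)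
    where
    𝒫 : Fam St
    𝒫 Y = isYes (em {P Y})
    encode : P ⊆ (_∈F 𝒫)
    encode PY = Equivalence.to T-≡ (fromWitness PY)
    decode : (_∈F 𝒫) ⊆ P
    decode Y∈𝒫 = toWitness (Equivalence.from T-≡ Y∈𝒫)
    ∩𝒫 : IntersectionClosed (_∈F 𝒫)
    ∩𝒫 𝓕 h X X≐ = encode (∩P 𝓕 (λ Y Y∈𝓕 → decode (h Y Y∈𝓕)) X X≐)
    ∪𝒫 : UnionClosed (_∈F 𝒫)
    ∪𝒫 𝓕 h X X≐ = encode (∪P 𝓕 (λ Y Y∈𝓕 → decode (h Y Y∈𝓕)) X X≐)

module _ {St : Set} (S : Sub St) where

  SameSide : St → Pred St 0ℓ
  SameSide t y = ⟦ S ⟧ y ⇔ ⟦ S ⟧ t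

  ⟦S⟧≐SameSide : {t : St} → ⟦ S ⟧ t → ⟦ S ⟧ ≐ SameSide t
  ⟦S⟧≐SameSide t∈S = (λ y∈S → mk⇔ (λ _ → t∈S) (λ _ → y∈S)) , (λ e → Equivalence.from e t∈S)

  ∁⟦S⟧≐SameSide : {t : St} → ¬ ⟦ S ⟧ t → ∁ ⟦ S ⟧ ≐ SameSide t
  ∁⟦S⟧≐SameSide t∉S =
    (λ y∉S → mk⇔ (⊥-elim ∘ y∉S) (⊥-elim ∘ t∉S)) , (λ e y∈S → t∉S (Equivalence.to e y∈S))

module _ {St : Set} (A : Fam St) (S : Sub St) where

  IsRefinedBlock⇔ : {X : Pred St 0ℓ} →
                    IsRefinedBlock A S X ⇔ ∃ λ t → X ≐ (Block A t ∩ SameSide S t)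
  IsRefinedBlock⇔ = mk⇔ to from
    where
    to : ∀ {X} → IsRefinedBlock A S X → ∃ λ t → X ≐ (Block A t ∩ SameSide S t)
    to (B , B-block , inj₁ ((t , Bt , t∈S) , X≐)) =
      t , ≐-trans X≐ (∩-cong (IsPrBlock-rep A B-block Bt) (⟦S⟧≐SameSide S t∈S))
    to (B , B-block , inj₂ ((t , Bt , t∉S) , X≐)) =
      t , ≐-trans X≐ (∩-cong (IsPrBlock-rep A B-block Bt) (∁⟦S⟧≐SameSide S t∉S))
    from : ∀ {X} → (∃ λ t → X ≐ (Block A t ∩ SameSide S t)) → IsRefinedBlock A S X
    from (t , X≐) with S t ≟ true
    ... | yes t∈S = Block A t , (t , ≐-refl) ,
          inj₁ ((t , ≐-refl , t∈S) , ≐-trans X≐ (∩-cong ≐-refl (≐-sym (⟦S⟧≐SameSide S t∈S))))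
    ... | no t∉S = Block A t , (t , ≐-refl) ,
          inj₂ ((t , ≐-refl , t∉S) , ≐-trans X≐ (∩-cong ≐-refl (≐-sym (∁⟦S⟧≐SameSide S t∉S))))

  IsRefinedBlock-satisfiable : {X : Pred St 0ℓ} → IsRefinedBlock A S X → Satisfiable X
  IsRefinedBlock-satisfiable (_ , _ , inj₁ ((t , t∈B∩S) , _ , B∩S⊆X)) = t , B∩S⊆X t∈B∩S
  IsRefinedBlock-satisfiable (_ , _ , inj₂ ((t , t∈B∖S) , _ , B∖S⊆X)) = t , B∖S⊆X t∈B∖S

module Refinement (em : ExcludedMiddle 0ℓ) {St : Set} {A : Fam St} {S : Sub St}
                  {A′ : Fam St} (A′-closure : IsDClosure (A ∪｛ S ｝) A′) where

  AboveS : St → Pred St 0ℓ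
  AboveS t x = ⟦ S ⟧ t → ⟦ S ⟧ x

  _⊑_ : Rel St 0ℓ
  s ⊑ x = μ A ｛ s ｝ x × AboveS s x

  A′-upClosed : (_∈F A′) ⊆ UpClosed _⊑_
  A′-upClosed = IsDClosure-ind em A′-closure (UpClosed _⊑_) generator-upClosed
                  UpClosed-∩closed UpClosed-∪closed
    where
    generator-upClosed : (A ∪｛ S ｝) ⊆ UpClosed _⊑_
    generator-upClosed (inj₁ X∈A) (s≤x , _) Xs = s≤x _ X∈A (λ { refl → Xs })
    generator-upClosed (inj₂ (X⊆S , S⊆X)) (_ , S-mono) Xs = S⊆X (S-mono (X⊆S Xs))

  μA′-singleton : (s : St) → μ A′ ｛ s ｝ ≐ (s ⊑_)
  μA′-singleton s = to , from
    where
    to : μ A′ ｛ s ｝ ⊆ (s ⊑_)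
    to x∈μ′ = (λ X X∈A s∈X → x∈μ′ X (proj₁ A′-closure X (inj₁ X∈A)) s∈X)
            , (λ s∈S → x∈μ′ S (proj₁ A′-closure S (inj₂ ≐-refl)) (λ { refl → s∈S }))
    from : (s ⊑_) ⊆ μ A′ ｛ s ｝
    from s⊑x X X∈A′ s∈X = A′-upClosed X∈A′ s⊑x (s∈X refl)

  Block-A′ : (t : St) → Block A′ t ≐ (Block A t ∩ SameSide S t)
  Block-A′ t = to , from
    where
    to : Block A′ t ⊆ (Block A t ∩ SameSide S t)
    to t~y with Equivalence.to (Block⇔ A′) t~y
    ... | t≤′y , y≤′t with proj₁ (μA′-singleton t) t≤′y | proj₁ (μA′-singleton _) y≤′t
    ... | t≤y , t∈S→y∈S | y≤t , y∈S→t∈S =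
      Equivalence.from (Block⇔ A) (t≤y , y≤t) , mk⇔ y∈S→t∈S t∈S→y∈S
    from : (Block A t ∩ SameSide S t) ⊆ Block A′ t
    from (t~y , y∈S⇔t∈S) with Equivalence.to (Block⇔ A) t~y
    ... | t≤y , y≤t = Equivalence.from (Block⇔ A′)
      ( proj₂ (μA′-singleton t) (t≤y , Equivalence.from y∈S⇔t∈S)
      , proj₂ (μA′-singleton _) (y≤t , Equivalence.to y∈S⇔t∈S))

  IsPrBlock-A′⇔IsRefinedBlock : (X : Pred St 0ℓ) → IsPrBlock A′ X ⇔ IsRefinedBlock A S X
  IsPrBlock-A′⇔IsRefinedBlock X = ⇔.trans
    (mk⇔ (λ (t , X≐) → t , ≐-trans X≐ (Block-A′ t))
         (λ (t , X≐) → t , ≐-trans X≐ (≐-sym (Block-A′ t))))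
    (⇔.sym (IsRefinedBlock⇔ A S))

  ⊴A′⇔ : {B′ C′ B : Pred St 0ℓ} {t : St} → IsRefinedBlock A S B′ → IsParent A B′ B →
         B′ t → C′ ⊴[ A′ ] B′ ⇔ C′ ⊆ (μ A B ∩ AboveS t)
  ⊴A′⇔ {B′} {B = B} {t} B′-block (B-block , B′⊆B) B′t = ⇔.trans (⊴⇔⊆μ A′) (⊆-respʳ-≐ μA′B′≐)
    where
    μA′B′≐ : μ A′ B′ ≐ (μ A B ∩ AboveS t)
    μA′B′≐ =
      ≐-trans (μ-IsPrBlock A′ (Equivalence.from (IsPrBlock-A′⇔IsRefinedBlock B′) B′-block) B′t)
        (≐-trans (μA′-singleton t) (∩-cong (≐-sym (μ-IsPrBlock A B-block (B′⊆B B′t))) ≐-refl))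

  ⊴A′⇔-outside-S : {B′ C′ B : Pred St 0ℓ} → IsRefinedBlock A S B′ → IsParent A B′ B →
                   Empty (B′ ∩ ⟦ S ⟧) → C′ ⊴[ A′ ] B′ ⇔ C′ ⊆ μ A B
  ⊴A′⇔-outside-S B′-block parent empty with IsRefinedBlock-satisfiable A S B′-block
  ... | t , B′t = ⇔.trans (⊴A′⇔ B′-block parent B′t)
    (⊆-respʳ-≐ (proj₁ , (λ x∈μ → x∈μ , λ t∈S → ⊥-elim (empty t (B′t , t∈S)))))

  ⊴A′⇔-meets-S : {B′ C′ B : Pred St 0ℓ} → IsRefinedBlock A S B′ → IsParent A B′ B →
                 ¬ Empty (B′ ∩ ⟦ S ⟧) → C′ ⊴[ A′ ] B′ ⇔ C′ ⊆ (μ A B ∩ ⟦ S ⟧)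
  ⊴A′⇔-meets-S B′-block parent nonempty
    with em⇒dne em (λ unsat → nonempty (λ y y∈B′∩S → unsat (y , y∈B′∩S)))
  ... | t , B′t , t∈S = ⇔.trans (⊴A′⇔ B′-block parent B′t)
    (⊆-respʳ-≐ (map₂ (λ S-mono → S-mono t∈S) , map₂ (λ x∈S _ → x∈S)))

lemma5p3 : ExcludedMiddle 0ℓ →
    {St : Set} (A : Fam St) (S : Sub St) (A' : Fam St) →
    Disjunctive A →
    IsDClosure (A ∪｛ S ｝) A' →
    (∀ (X : Pred St 0ℓ) → IsPrBlock A' X ⇔ IsRefinedBlock A S X)
    × (∀ (B' C' : Pred St 0ℓ) → IsRefinedBlock A S B' → IsRefinedBlock A S C' →
         ∀ (B : Pred St 0ℓ) → IsParent A B' B →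
         (Empty (B' ∩ ⟦ S ⟧) → (C' ⊴[ A' ] B' ⇔ C' ⊆ μ A B))
         × (¬ Empty (B' ∩ ⟦ S ⟧) → (C' ⊴[ A' ] B' ⇔ C' ⊆ (μ A B ∩ ⟦ S ⟧))))
lemma5p3 em A S A′ _ A′-closure =
  IsPrBlock-A′⇔IsRefinedBlock ,
  λ _ _ B′-block _ _ parent → ⊴A′⇔-outside-S B′-block parent , ⊴A′⇔-meets-S B′-block parent
  where open Refinement em A′-closure
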